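{- Let $f$ be a diffusion, and let $S(S_1\bar S)$ and $S'(S'_1\bar S')$ be progressive sort-signatures refining its type-signature. If $f$ is stabilising with respect to $S(S_1\bar S)$ and $S(S_1\bar S)\le_{\mathrm{stab}} S'(S'_1\bar S')$, then $f$ is stabilising with respect to $S'(S'_1\bar S')$.
   Context: Each type $T$ has a set $[\![T]\!]$ of values with a total noetherian order $\le_T$. Each type $T$ has a set of sorts refining it; each sort $S$ denotes $[\![S]\!]\subseteq[\![T]\!]$; $S\le S'$ (subsorting) iff $[\![S]\!]\subseteq[\![S']\!]$; $\top_S$ is the maximum of $[\![S]\!]$ w.r.t. $\le_T$. A diffusion is a (side-effect free) function $f$ with semantics $[\![f]\!]$ and type-signature $T(T_1,\dots,T_n)$, $n\ge1$, with $T=T_1$; a sort-signature $S(S_1,\dots,S_n)$ refines it if each $S_i$ refines $T_i$ and $S$ refines $T$. $f$ has sort-signature $S(S_1,\dots,S_n)$ if $[\![f]\!](\bar v)\in[\![S]\!]$ for all $\bar v\in[\![S_1]\!]\times\dots\times[\![S_n]\!]$. Progressive subsorting: $S\le^{\triangleright}S'$ iff $[\![S]\!]\subseteq[\![S']\!]$ and $\top_S=\top_{S'}$. A sort-signature $S(S_1,\dots,S_n)$ is progressive if $S\le^{\triangleright}S_1$. Stabilising subsigning between progressive sort-signatures: $S(S_1\bar S)\le_{\mathrm{stab}}S'(S'_1\bar S')$ iff $S\le^{\triangleright}S'$, $S'_1\le^{\triangleright}S_1$ and $\bar S'\le\bar S$ componentwise. A diffusion $f$ is stabilising with respect to a sort-signature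 $S(S_1,\bar S)$ that it has, with $S\le S_1$, if for all $\bar v\in[\![\bar S]\!]$: (1) for all $v,v'\in[\![S_1]\!]$, $v\le v'$ implies $[\![f]\!](v,\bar v)\le[\![f]\!](v',\bar v)$; (2) $[\![f]\!](\top_{S_1},\bar v)=\top_{S_1}$, and $v<[\![f]\!](v,\bar v)$ for all $v\in[\![S_1]\!]\setminus\{\top_{S_1}\}$. -}

module Defs where

open import Data.Nat using (ℕ; suc)
open import Data.Fin using (Fin)
open import Data.Product using (_×_; Σ)
open import Relation.Binary.PropositionalEquality using (_≡_; _≢_)
open import Relation.Binary.Structures using (IsTotalOrder)
open import Induction.WellFounded using (WellFounded)

-- A type: a set of values with a total noetherian order
-- (noetherian = no infinite strictly ascending chains, i.e. _>_ is well-founded).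
record Type : Set₁ where
  field
    Val          : Set
    _≤_          : Val → Val → Set
    isTotalOrder : IsTotalOrder _≡_ _≤_

  _<_ : Val → Val → Set
  x < y = (x ≤ y) × (x ≢ y)

  field
    noetherian   : WellFounded (λ x y → y < x)

open Type public

record Sort (T : Type) : Set₁ where
  field
    ∈S     : Val T → Set
    top    : Val T
    top∈   : ∈S top
    topMax : ∀ v → ∈S v → _≤_ T v top

open Sort public

_⊑_ : {T : Type} → Sort T → Sort T → Set
S ⊑ S' = ∀ v → ∈S S v → ∈S S' v

_⊑▷_ : {T : Type} → Sort T → Sort T → Set
S ⊑▷ S' = (S ⊑ S') × (top S ≡ top S')

-- A diffusion of type-signature T(T, T₂, …, Tₙ), n = 1 + k ≥ 1.
-- The remaining arguments T₂ … Tₙ are the family Ts indexed by Fin k.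
Args : {k : ℕ} → (Fin k → Type) → Set
Args Ts = ∀ i → Val (Ts i)

Diffusion : {k : ℕ} → Type → (Fin k → Type) → Set
Diffusion T Ts = Val T → Args Ts → Val T

record SortSig {k : ℕ} (T : Type) (Ts : Fin k → Type) : Set₁ where
  constructor sig
  field
    res  : Sort T
    arg₁ : Sort T
    args : ∀ i → Sort (Ts i)

open SortSig public

InArgs : {k : ℕ} {Ts : Fin k → Type} → (∀ i → Sort (Ts i)) → Args Ts → Set
InArgs Ss vs = ∀ i → ∈S (Ss i) (vs i)

HasSig : {k : ℕ} {T : Type} {Ts : Fin k → Type} →
         Diffusion T Ts → SortSig T Ts → Set
HasSig f σ = ∀ v vs → ∈S (arg₁ σ) v → InArgs (args σ) vs → ∈S (res σ) (f v vs)

Progressive : {k : ℕ} {T : Type} {Ts : Fin k → Type} → SortSig T Ts → Set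
Progressive σ = res σ ⊑▷ arg₁ σ

_≤stab_ : {k : ℕ} {T : Type} {Ts : Fin k → Type} → SortSig T Ts → SortSig T Ts → Set
σ ≤stab σ' = (res σ ⊑▷ res σ') × (arg₁ σ' ⊑▷ arg₁ σ) × (∀ i → args σ' i ⊑ args σ i)

Stabilising : {k : ℕ} {T : Type} {Ts : Fin k → Type} →
              Diffusion T Ts → SortSig T Ts → Set
Stabilising {T = T} f σ =
  HasSig f σ × (res σ ⊑ arg₁ σ) ×
  (∀ vs → InArgs (args σ) vs →
     (∀ v v' → ∈S (arg₁ σ) v → ∈S (arg₁ σ) v' → _≤_ T v v' → _≤_ T (f v vs) (f v' vs))
   × (f (top (arg₁ σ)) vs ≡ top (arg₁ σ))
   × (∀ v → ∈S (arg₁ σ) v → v ≢ top (arg₁ σ) → _<_ T v (f v vs)))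

-- Shrinking the argument sort S₁ to S'₁ while keeping its maximum preserves
-- monotonicity, the fixed point ⊤ and strict inflation below ⊤, since these
-- are conditions on individual elements of S₁ (and on ⊤ itself).  The
-- sort-signature is weakened in the usual way: results may be enlarged,
-- arguments shrunk.
module Submission where

open import Defs
open import Data.Nat using (ℕ)
open import Data.Fin using (Fin)
open import Data.Product using (_×_; _,_)
open import Relation.Binary.PropositionalEquality using (_≡_; _≢_; subst; sym; trans)

module _ {T : Type} where

  MonotoneOn : Sort T → (Val T → Val T) → Set
  MonotoneOn S g = ∀ v v' → ∈S S v → ∈S S v' → _≤_ T v v' → _≤_ T (g v) (g v')

  StabilisesAt : Sort T → (Val T → Val T) → Set
  StabilisesAt S g =
    MonotoneOn S g × (g (top S) ≡ top S) × (∀ v → ∈S S v → v ≢ top S → _<_ T v (g v))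

  MonotoneOn-⊑ : ∀ {S S' g} → S' ⊑ S → MonotoneOn S g → MonotoneOn S' g
  MonotoneOn-⊑ S'⊑S mono v v' v∈ v'∈ = mono v v' (S'⊑S v v∈) (S'⊑S v' v'∈)

  StabilisesAt-⊑▷ : ∀ {S S' g} → S' ⊑▷ S → StabilisesAt S g → StabilisesAt S' g
  StabilisesAt-⊑▷ {S} {S'} {g} (S'⊑S , top≡) (mono , fixesTop , inflates) =
      MonotoneOn-⊑ {S} {S'} S'⊑S mono
    , subst (λ t → g t ≡ t) (sym top≡) fixesTop
    , λ v v∈ v≢top → inflates v (S'⊑S v v∈) (λ v≡top → v≢top (trans v≡top (sym top≡)))

InArgs-⊑ : {k : ℕ} {Ts : Fin k → Type} {Ss Ss' : ∀ i → Sort (Ts i)} →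
           (∀ i → Ss' i ⊑ Ss i) → ∀ vs → InArgs Ss' vs → InArgs Ss vs
InArgs-⊑ Ss'⊑Ss vs vs∈ i = Ss'⊑Ss i (vs i) (vs∈ i)

HasSig-weaken : {k : ℕ} {T : Type} {Ts : Fin k → Type} {f : Diffusion T Ts}
                {σ σ' : SortSig T Ts} →
                res σ ⊑ res σ' → arg₁ σ' ⊑ arg₁ σ → (∀ i → args σ' i ⊑ args σ i) →
                HasSig f σ → HasSig f σ'
HasSig-weaken {f = f} {σ} {σ'} res⊑ arg₁⊑ args⊑ hasσ v vs v∈ vs∈ =
  res⊑ (f v vs) (hasσ v vs (arg₁⊑ v v∈) (InArgs-⊑ {Ss = args σ} {args σ'} args⊑ vs vs∈))

proposition4p6 : {k : ℕ} (T : Type) (Ts : Fin k → Type) (f : Diffusion T Ts)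
                 (σ σ' : SortSig T Ts) →
                 Progressive σ → Progressive σ' →
                 Stabilising f σ → σ ≤stab σ' → Stabilising f σ'
proposition4p6 T Ts f σ σ' _ (res'⊑arg₁' , _) (hasσ , _ , stabilises)
               ((res⊑ , _) , arg₁⊑▷@(arg₁⊑ , _) , args⊑) =
    HasSig-weaken {f = f} {σ} {σ'} res⊑ arg₁⊑ args⊑ hasσ
  , res'⊑arg₁'
  , λ vs vs∈ → StabilisesAt-⊑▷ {S = arg₁ σ} {arg₁ σ'} {λ v → f v vs} arg₁⊑▷
                 (stabilises vs (InArgs-⊑ {Ss = args σ} {args σ'} args⊑ vs vs∈))
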